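{- Let $\mathcal{S}=\langle\mathbf{Fm},\vdash\rangle$ be a logic over a language containing a binary connective $\longrightarrow$, in which the Deduction theorem holds: for all $\Sigma\cup\{\alpha,\beta\}\subseteq\mathit{Fm}$, $\Sigma\cup\{\alpha\}\vdash\beta$ implies $\Sigma\vdash\alpha\longrightarrow\beta$. Then the Deduction theorem holds in its left variable inclusion companion $\mathcal{S}^l=\langle\mathbf{Fm},\vdash^l\rangle$: for all $\Sigma\cup\{\alpha,\beta\}\subseteq\mathit{Fm}$, if $\Sigma\cup\{\alpha\}\vdash^l\beta$ then $\Sigma\vdash^l\alpha\longrightarrow\beta$.
   Context: $\mathbf{Fm}$ is the formula algebra of a logical language (connectives of finite arity) over a countably infinite set $V$ of variables, universe $\mathit{Fm}$. A logic is a pair $\langle\mathbf{Fm},\vdash\rangle$ with $\vdash\subseteq\mathcal{P}(\mathit{Fm})\times\mathit{Fm}$ reflexive, transitive (if $\Delta\vdash\psi$ for all $\psi\in\Sigma$ and $\Sigma\vdash\varphi$ then $\Delta\vdash\varphi$) and closed under substitutions. $\mathrm{var}(\varphi)$ is the set of variables of $\varphi$, $\mathrm{var}(\Gamma)=\bigcup_{\gamma\in\Gamma}\mathrm{var}(\gamma)$. Left variable inclusion companion: $\Gamma\vdash^l\varphi$ iff there is $\Gamma'\subseteq\Gamma$ with $\mathrm{var}(\Gamma')\subseteq\mathrm{var}(\varphi)$ and $\Gamma'\vdash\varphi$. -}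

module Defs where

open import Level using (0ℓ)
open import Data.Nat using (ℕ)
open import Data.Vec using (Vec; []; _∷_)
open import Data.Product using (Σ; _×_; ∃)
open import Relation.Unary using (Pred; _∈_; _⊆_; _∪_; ｛_｝)
open import Relation.Binary.PropositionalEquality using (_≡_; subst; sym)

record Language : Set₁ where
  field
    Con   : Set
    arity : Con → ℕ

module _ (L : Language) where
  open Language L

  data Fm : Set where
    var : ℕ → Fm
    app : (c : Con) → Vec Fm (arity c) → Fm

  mutual
    data Occurs (x : ℕ) : Fm → Set where
      here  : Occurs x (var x)
      there : ∀ {c} {args : Vec Fm (arity c)} →
              OccursArgs x args → Occurs x (app c args)

    data OccursArgs (x : ℕ) : ∀ {n} → Vec Fm n → Set where
      hd : ∀ {n φ} {φs : Vec Fm n} → Occurs x φ → OccursArgs x (φ ∷ φs)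
      tl : ∀ {n φ} {φs : Vec Fm n} → OccursArgs x φs → OccursArgs x (φ ∷ φs)

  VarsIncluded : Pred Fm 0ℓ → Fm → Set
  VarsIncluded Γ φ = ∀ x → (∃ λ γ → γ ∈ Γ × Occurs x γ) → Occurs x φ

  Subst : Set
  Subst = ℕ → Fm

  mutual
    _⟪_⟫ : Fm → Subst → Fm
    var x    ⟪ σ ⟫ = σ x
    app c as ⟪ σ ⟫ = app c (substArgs as σ)

    substArgs : ∀ {n} → Vec Fm n → Subst → Vec Fm n
    substArgs []       σ = []
    substArgs (a ∷ as) σ = (a ⟪ σ ⟫) ∷ substArgs as σ

  image : Subst → Pred Fm 0ℓ → Pred Fm 0ℓ
  image σ Γ ψ = ∃ λ γ → γ ∈ Γ × ψ ≡ γ ⟪ σ ⟫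

  Consequence : Set₂
  Consequence = Pred Fm 0ℓ → Fm → Set₁

  record IsLogic (_⊢_ : Consequence) : Set₁ where
    field
      reflexive    : ∀ {Γ φ} → φ ∈ Γ → Γ ⊢ φ
      transitive   : ∀ {Δ Σ φ} → (∀ {ψ} → ψ ∈ Σ → Δ ⊢ ψ) → Σ ⊢ φ → Δ ⊢ φ
      structural   : ∀ (σ : Subst) {Γ φ} → Γ ⊢ φ → image σ Γ ⊢ (φ ⟪ σ ⟫)

  LeftCompanion : Consequence → Consequence
  LeftCompanion _⊢_ Γ φ =
    Σ (Pred Fm 0ℓ) λ Γ' → Γ' ⊆ Γ × VarsIncluded Γ' φ × Γ' ⊢ φ

  binary : (c : Con) → arity c ≡ 2 → Fm → Fm → Fm
  binary c eq α β = app c (subst (Vec Fm) (sym eq) (α ∷ β ∷ []))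

  DeductionTheorem : Consequence → (Fm → Fm → Fm) → Set₁
  DeductionTheorem _⊢_ _⟶_ =
    ∀ (Σ' : Pred Fm 0ℓ) (α β : Fm) → (Σ' ∪ ｛ α ｝) ⊢ β → Σ' ⊢ (α ⟶ β)

-- If Γ ⊆ Σ ∪ {α} witnesses Σ ∪ {α} ⊢ˡ β, keep only the premises in Σ: every formula of Γ
-- lies in (Γ ∩ Σ) ∪ {α}, so (Γ ∩ Σ) ∪ {α} ⊢ β and the deduction theorem of ⊢ gives
-- Γ ∩ Σ ⊢ α ⟶ β.  Since Γ ∩ Σ ⊆ Γ, its variables occur in β, hence in α ⟶ β.
module Submission where

open import Defs
open import Relation.Binary.PropositionalEquality using (_≡_; refl; subst; sym)
open import Data.Vec using (Vec; []; _∷_)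
open import Data.Product using (_,_; proj₂)
open import Data.Sum using (inj₁; inj₂)
open import Relation.Unary using (_⊆_; _∪_; _∩_; ｛_｝)

⊆-∪-restrict : ∀ {A : Set} {Γ Σ' : A → Set} {a : A} →
               Γ ⊆ Σ' ∪ ｛ a ｝ → Γ ⊆ (Γ ∩ Σ') ∪ ｛ a ｝
⊆-∪-restrict Γ⊆ γ∈Γ with Γ⊆ γ∈Γ
... | inj₁ γ∈Σ = inj₁ (γ∈Γ , γ∈Σ)
... | inj₂ γ≡a = inj₂ γ≡a

module _ {L : Language} where
  open Language L

  occurs-binaryʳ : ∀ {x} (c : Con) (eq : arity c ≡ 2) (α β : Fm L) →
                   Occurs L x β → Occurs L x (binary L c eq α β)
  occurs-binaryʳ c eq α β x∈β = there (second eq)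
    where
    second : ∀ {n} (eq : n ≡ 2) → OccursArgs L _ (subst (Vec (Fm L)) (sym eq) (α ∷ β ∷ []))
    second refl = tl (hd x∈β)

  module _ {_⊢_ : Consequence L} (logic : IsLogic L _⊢_) where
    open IsLogic logic

    monotone : ∀ {Γ Δ φ} → Γ ⊆ Δ → Γ ⊢ φ → Δ ⊢ φ
    monotone Γ⊆Δ = transitive (λ ψ∈Γ → reflexive (Γ⊆Δ ψ∈Γ))

theorem4p1 : (L : Language) (imp : Language.Con L) (imp-binary : Language.arity L imp ≡ 2)
             (_⊢_ : Consequence L) → IsLogic L _⊢_ →
             DeductionTheorem L _⊢_ (binary L imp imp-binary) →
             DeductionTheorem L (LeftCompanion L _⊢_) (binary L imp imp-binary)
theorem4p1 L imp imp-binary _⊢_ logic deduction Σ' α β (Γ' , Γ'⊆ , vars⊆ , Γ'⊢β) =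
  Γ' ∩ Σ' , proj₂ , vars⊆′ , deduction (Γ' ∩ Σ') α β (monotone logic (⊆-∪-restrict Γ'⊆) Γ'⊢β)
  where
  vars⊆′ : VarsIncluded L (Γ' ∩ Σ') (binary L imp imp-binary α β)
  vars⊆′ x (γ , (γ∈Γ' , _) , x∈γ) =
    occurs-binaryʳ imp imp-binary α β (vars⊆ x (γ , γ∈Γ' , x∈γ))
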